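{- Let $A$ and $B$ be stable matching instances on the same set $\mathcal{W}=\{w_1,\dots,w_n\}$ of workers and the same set $\mathcal{F}=\{f_1,\dots,f_n\}$ of firms, and suppose $A$ and $B$ are $(1,n)$, i.e. every worker other than $w_1$ has the same preference list in $A$ as in $B$ (firms and $w_1$ may have arbitrary, possibly different, preferences in $A$ and $B$). Then $\mathcal{M}_A \cap \mathcal{M}_B$ is a sublattice of both $\mathcal{L}_A$ and $\mathcal{L}_B$.
   Context: A stable matching instance $I$ on workers $\mathcal{W}$ and firms $\mathcal{F}$ (with $|\mathcal{W}|=|\mathcal{F}|=n$) assigns to every agent a strict total order over the agents of the other side. For a perfect matching $M$, a pair $(w,f)\notin M$ is blocking under $I$ if $w$ prefers $f$ to $M(w)$ and $f$ prefers $w$ to $M(f)$ (both under $I$); $M$ is stable under $I$ if it has no blocking pair. $\mathcal{M}_I$ is the set of matchings stable under $I$, and $\mathcal{L}_I$ is the lattice on $\mathcal{M}_I$ ordered by $M\preceq_I M'$ iff every worker weakly prefers (under $I$) its $M$-partner to its $M'$-partner. The join $M\vee_I M'$ assigns every worker its less preferred (under $I$) partner among $M(w),M'(w)$, and the meet $M\wedge_I M'$ its more preferred one; both are stable under $I$. A subset $S\subseteq \mathcal{M}_I$ is a sublattice of $\mathcal{L}_I$ if it is closed under $\vee_I$ and $\wedge_I$. -}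

module Defs where

open import Data.Nat using (ℕ; suc)
open import Data.Fin using (Fin; zero; _<_)
open import Data.Fin.Properties using (_<?_)
open import Data.Product using (_×_; Σ)
open import Relation.Binary.PropositionalEquality using (_≡_; _≢_)
open import Relation.Nullary using (¬_; yes; no)
open import Function.Definitions using (Injective)

-- Workers and firms are both indexed by Fin n.
-- A strict total order over n agents is given by an injective ranking
-- function  rank : Fin n → Fin n  ; rank x < rank y  means x is preferred to y.
record Pref (n : ℕ) : Set where
  field
    rank     : Fin n → Fin n
    rank-inj : Injective _≡_ _≡_ rank
open Pref public

Prefers : ∀ {n} → Pref n → Fin n → Fin n → Set
Prefers p x y = rank p x < rank p y

record Instance (n : ℕ) : Set where
  field
    wpref : Fin n → Pref n
    fpref : Fin n → Pref n
open Instance public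

-- A (candidate) matching is given by the worker -> firm assignment.
-- It is a perfect matching when this assignment is injective (hence bijective).
Assignment : ℕ → Set
Assignment n = Fin n → Fin n

IsPerfectMatching : ∀ {n} → Assignment n → Set
IsPerfectMatching M = Injective _≡_ _≡_ M

-- (w , f) ∉ M is blocking under I: w prefers f to M(w), and f prefers w
-- to its partner M(f), i.e. to every w' with M w' ≡ f.
-- (for a perfect matching M(f) is the unique such w'; stating it for all
--  such w' avoids inverting M.)
Blocking : ∀ {n} → Instance n → Assignment n → Fin n → Fin n → Set
Blocking I M w f =
  M w ≢ f × Prefers (wpref I w) f (M w)
    × (∀ w' → M w' ≡ f → Prefers (fpref I f) w w')

IsStable : ∀ {n} → Instance n → Assignment n → Set
IsStable I M = IsPerfectMatching M × (∀ w f → ¬ Blocking I M w f)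

join : ∀ {n} → Instance n → Assignment n → Assignment n → Assignment n
join I M M' w with rank (wpref I w) (M w) <? rank (wpref I w) (M' w)
... | yes _ = M' w
... | no  _ = M w

meet : ∀ {n} → Instance n → Assignment n → Assignment n → Assignment n
meet I M M' w with rank (wpref I w) (M w) <? rank (wpref I w) (M' w)
... | yes _ = M w
... | no  _ = M' w

InBoth : ∀ {n} → Instance n → Instance n → Assignment n → Set
InBoth A B M = IsStable A M × IsStable B M

IsSublattice : ∀ {n} → Instance n → (Assignment n → Set) → Set
IsSublattice I S =
  (∀ M → S M → IsStable I M) ×
  (∀ M M' → S M → S M' → S (join I M M') × S (meet I M M'))

-- A and B are (1,n): all workers other than w₁ (= zero) have the same
-- preference list (same ranking) in A and B.
Is1n : ∀ {n} → Instance (suc n) → Instance (suc n) → Set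
Is1n A B = ∀ w → w ≢ zero → ∀ f → rank (wpref A w) f ≡ rank (wpref B w) f

-- Conway's lattice theorem rests on the fact that, for stable X and Y, a firm's
-- X-partner strictly prefers X to Y exactly when its Y-partner does; this makes
-- the workerwise join and meet perfect matchings, and for the join it also
-- means every firm gets the better of its two partners, so a blocking pair of
-- the join or meet would block X or Y.  For (1,n) instances the joins under A
-- and under B agree on every worker but w₁; being perfect matchings, they then
-- agree on w₁ too, so the A-join of two matchings stable under both is the
-- B-join, which is stable under B.  The same holds for meets.
module Submission where

open import Data.Nat using (ℕ; suc)
open import Defs

import Data.Nat.Properties as ℕ
open import Data.Fin using (Fin; zero; punchOut; _<_)
open import Data.Fin.Properties
  using (_<?_; _≟_; any?; injective⇒≤; punchOut-injective; <-cmp; <-irrefl; <-asym; <-trans)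
open import Data.Product using (_×_; ∃; _,_; proj₁; proj₂; swap; map)
open import Data.Empty using (⊥)
open import Data.Sum using (_⊎_; inj₁; inj₂)
open import Function using (_∘_)
open import Function.Definitions using (Injective)
open import Relation.Binary.Definitions using (tri<; tri≈; tri>)
open import Relation.Binary.PropositionalEquality
  using (_≡_; _≢_; _≗_; refl; sym; trans; cong; subst; subst₂)
open import Relation.Nullary using (¬_; yes; no; contradiction)
open import Relation.Unary using (Pred; Decidable)

injective⇒surjective : ∀ {N} (g : Fin N → Fin N) → Injective _≡_ _≡_ g →
  ∀ y → ∃ λ x → g x ≡ y
injective⇒surjective {suc N} g g-inj y with any? (λ x → g x ≟ y)
... | yes hit = hit
... | no miss = contradiction (injective⇒≤ g′-inj) ℕ.1+n≰n
  where
  y≢g : ∀ x → y ≢ g x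
  y≢g x y≡gx = miss (x , sym y≡gx)

  g′ : Fin (suc N) → Fin N
  g′ x = punchOut (y≢g x)

  g′-inj : Injective _≡_ _≡_ g′
  g′-inj {x} {x′} = g-inj ∘ punchOut-injective (y≢g x) (y≢g x′)

-- Extending σ on P by the identity off P gives an injection, hence a surjection.
invariant⇒onto : ∀ {N p} {P : Pred (Fin N) p} → Decidable P →
  (σ : Fin N → Fin N) → Injective _≡_ _≡_ σ → (∀ {x} → P x → P (σ x)) →
  ∀ {y} → P y → ∃ λ x → P x × σ x ≡ y
invariant⇒onto {N} {P = P} P? σ σ-inj σ-pres {y} Py = pull (injective⇒surjective ρ ρ-inj y)
  where
  ρ : Fin N → Fin N
  ρ x with P? x
  ... | yes _ = σ x
  ... | no  _ = x

  ρ-inj : Injective _≡_ _≡_ ρ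
  ρ-inj {x} {x′} ρx≡ρx′ with P? x | P? x′
  ... | yes _   | yes _    = σ-inj ρx≡ρx′
  ... | yes Px  | no ¬Px′  = contradiction (subst P ρx≡ρx′ (σ-pres Px)) ¬Px′
  ... | no ¬Px  | yes Px′  = contradiction (subst P (sym ρx≡ρx′) (σ-pres Px′)) ¬Px
  ... | no _    | no _     = ρx≡ρx′

  pull : ∃ (λ x → ρ x ≡ y) → ∃ λ x → P x × σ x ≡ y
  pull (x , ρx≡y) with P? x
  ... | yes Px = x , Px , ρx≡y
  ... | no ¬Px = contradiction (subst P (sym ρx≡y) Py) ¬Px

injective-agree-off-point : ∀ {N} {g h : Fin N → Fin N} →
  Injective _≡_ _≡_ g → Injective _≡_ _≡_ h →
  ∀ p → (∀ x → x ≢ p → g x ≡ h x) → g ≗ h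
injective-agree-off-point {g = g} {h} g-inj h-inj p agree x with x ≟ p
... | no  x≢p  = agree x x≢p
... | yes refl with injective⇒surjective h h-inj (g p)
...   | u , hu≡gp with u ≟ p
...     | yes refl = sym hu≡gp
...     | no  u≢p  = contradiction (g-inj (trans (agree u u≢p) hu≡gp)) u≢p

¬Prefers⇒Prefers : ∀ {n} (p : Pref n) {f g} → f ≢ g → ¬ Prefers p f g → Prefers p g f
¬Prefers⇒Prefers p {f} {g} f≢g f⊀g with <-cmp (rank p f) (rank p g)
... | tri< f≺g _ _ = contradiction f≺g f⊀g
... | tri≈ _ eq _  = contradiction (rank-inj p eq) f≢g
... | tri> _ _ g≺f = g≺f

module _ {N} (I : Instance N) where

  Better : Assignment N → Assignment N → Fin N → Set
  Better X Y w = Prefers (wpref I w) (X w) (Y w)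

  blocking : ∀ {M} → IsPerfectMatching M → ∀ {w f w′} → M w′ ≡ f →
    Prefers (wpref I w) f (M w) → Prefers (fpref I f) w w′ → Blocking I M w f
  blocking M-inj Mw′≡f f≺Mw w≺w′ =
    (λ Mw≡f → <-irrefl (cong (rank (wpref I _)) (sym Mw≡f)) f≺Mw) ,
    f≺Mw ,
    λ w″ Mw″≡f → subst (Prefers (fpref I _) _) (M-inj (trans Mw′≡f (sym Mw″≡f))) w≺w′

  IsStable-resp-≗ : ∀ {K K′} → K ≗ K′ → IsStable I K → IsStable I K′
  IsStable-resp-≗ {K} {K′} K≗K′ (K-inj , K-stable) = K′-inj , λ w f → K-stable w f ∘ blocks-K
    where
    K′-inj : Injective _≡_ _≡_ K′
    K′-inj {x} {y} eq = K-inj (trans (K≗K′ x) (trans eq (sym (K≗K′ y))))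

    blocks-K : ∀ {w f} → Blocking I K′ w f → Blocking I K w f
    blocks-K {w} {f} (K′w≢f , f≺K′w , w≺partners) =
      K′w≢f ∘ trans (sym (K≗K′ w)) ,
      subst (Prefers (wpref I w) f) (sym (K≗K′ w)) f≺K′w ,
      λ w″ Kw″≡f → w≺partners w″ (trans (sym (K≗K′ w″)) Kw″≡f)

  Better? : ∀ X Y → Decidable (Better X Y)
  Better? X Y w = rank (wpref I w) (X w) <? rank (wpref I w) (Y w)

  Better⇒≢ : ∀ {X Y w} → Better X Y w → X w ≢ Y w
  Better⇒≢ {w = w} better Xw≡Yw = <-irrefl (cong (rank (wpref I w)) Xw≡Yw) better

  firm-prefers-other-partner : ∀ {X Y} → IsStable I Y → ∀ {w v} →
    Better X Y w → Y v ≡ X w → Prefers (fpref I (X w)) v w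
  firm-prefers-other-partner {X} {Y} (Y-inj , Y-stable) {w} {v} better Yv≡Xw
    with <-cmp (rank (fpref I (X w)) v) (rank (fpref I (X w)) w)
  ... | tri< v≺w _ _ = v≺w
  ... | tri≈ _ eq _  = contradiction (subst (λ x → Y x ≡ X w) (rank-inj (fpref I (X w)) eq) Yv≡Xw)
                                     (Better⇒≢ {X} {Y} better ∘ sym)
  ... | tri> _ _ w≺v = contradiction (blocking Y-inj Yv≡Xw better w≺v) (Y-stable w (X w))

  better-closed : ∀ {X Y} → IsStable I X → IsStable I Y → ∀ {w v} →
    Better X Y w → Y v ≡ X w → Better X Y v
  better-closed {X} {Y} (X-inj , X-stable) Y-stab {w} {v} better Yv≡Xw with Better? X Y v
  ... | yes better′ = better′
  ... | no ¬better′ = contradiction (blocking X-inj refl Xw≺Xv v≺w) (X-stable v (X w))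
    where
    Xv≢Yv : X v ≢ Y v
    Xv≢Yv Xv≡Yv =
      Better⇒≢ {X} {Y} better (sym (subst (λ x → Y x ≡ X w) (X-inj (trans Xv≡Yv Yv≡Xw)) Yv≡Xw))

    Xw≺Xv : Prefers (wpref I v) (X w) (X v)
    Xw≺Xv = subst (λ f → Prefers (wpref I v) f (X v)) Yv≡Xw
              (¬Prefers⇒Prefers (wpref I v) Xv≢Yv ¬better′)

    v≺w : Prefers (fpref I (X w)) v w
    v≺w = firm-prefers-other-partner {X} Y-stab better Yv≡Xw

  -- The converse of better-closed needs a counting argument: Y⁻¹ ∘ X maps the
  -- workers preferring X into themselves, hence onto themselves.
  better-reflected : ∀ {X Y} → IsStable I X → IsStable I Y → ∀ {a b} →
    X a ≡ Y b → Better X Y b → Better X Y a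
  better-reflected {X} {Y} X-stab@(X-inj , _) Y-stab@(Y-inj , _) {a} {b} Xa≡Yb better =
    pull (invariant⇒onto (Better? X Y) σ σ-inj
            (λ better-x → better-closed X-stab Y-stab better-x (σ-spec _)) better)
    where
    σ : Fin N → Fin N
    σ x = proj₁ (injective⇒surjective Y Y-inj (X x))

    σ-spec : ∀ x → Y (σ x) ≡ X x
    σ-spec x = proj₂ (injective⇒surjective Y Y-inj (X x))

    σ-inj : Injective _≡_ _≡_ σ
    σ-inj {x} {x′} σx≡σx′ = X-inj (trans (sym (σ-spec x)) (trans (cong Y σx≡σx′) (σ-spec x′)))

    pull : ∃ (λ x → Better X Y x × σ x ≡ b) → Better X Y a
    pull (x , better-x , σx≡b) =
      subst (Better X Y) (X-inj (trans (sym (σ-spec x)) (trans (cong Y σx≡b) (sym Xa≡Yb)))) better-x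

  worse-partner-preferred : ∀ {X Y} → IsStable I X → IsStable I Y → ∀ {w′ u f} →
    Y w′ ≡ f → X u ≡ f → ¬ Better Y X w′ → u ≡ w′ ⊎ Prefers (fpref I f) w′ u
  worse-partner-preferred {X} {Y} X-stab@(X-inj , _) Y-stab {w′} Yw′≡Xu refl ¬better with X w′ ≟ Y w′
  ... | yes Xw′≡Yw′ = inj₁ (sym (X-inj (trans Xw′≡Yw′ Yw′≡Xu)))
  ... | no  Xw′≢Yw′ = inj₂ (firm-prefers-other-partner {X} Y-stab better-u Yw′≡Xu)
    where
    better-u : Better X Y _
    better-u = better-reflected X-stab Y-stab (sym Yw′≡Xu)
                 (¬Prefers⇒Prefers (wpref I w′) (Xw′≢Yw′ ∘ sym) ¬better)

  join-cases : ∀ M M′ w →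
    (Better M M′ w × join I M M′ w ≡ M′ w) ⊎ (¬ Better M M′ w × join I M M′ w ≡ M w)
  join-cases M M′ w with rank (wpref I w) (M w) <? rank (wpref I w) (M′ w)
  ... | yes better = inj₁ (better , refl)
  ... | no ¬better = inj₂ (¬better , refl)

  meet-cases : ∀ M M′ w →
    (Better M M′ w × meet I M M′ w ≡ M w) ⊎ (¬ Better M M′ w × meet I M M′ w ≡ M′ w)
  meet-cases M M′ w with rank (wpref I w) (M w) <? rank (wpref I w) (M′ w)
  ... | yes better = inj₁ (better , refl)
  ... | no ¬better = inj₂ (¬better , refl)

  join-comm : ∀ M M′ → join I M M′ ≗ join I M′ M
  join-comm M M′ w with join-cases M M′ w | join-cases M′ M w
  ... | inj₁ (better , _)    | inj₁ (better′ , _) = contradiction better′ (<-asym better)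
  ... | inj₁ (_ , J≡M′)      | inj₂ (_ , J′≡M′)   = trans J≡M′ (sym J′≡M′)
  ... | inj₂ (_ , J≡M)       | inj₁ (_ , J′≡M)    = trans J≡M (sym J′≡M)
  ... | inj₂ (¬better , J≡M) | inj₂ (¬better′ , J′≡M′) with M w ≟ M′ w
  ...   | yes Mw≡M′w = trans J≡M (trans Mw≡M′w (sym J′≡M′))
  ...   | no  Mw≢M′w = contradiction (¬Prefers⇒Prefers (wpref I w) Mw≢M′w ¬better) ¬better′

  module _ {M M′} (M-stab : IsStable I M) (M′-stab : IsStable I M′) where
    private
      M-inj  = proj₁ M-stab
      M′-inj = proj₁ M′-stab

    join-injective : Injective _≡_ _≡_ (join I M M′)
    join-injective {x} {y} Jx≡Jy with join-cases M M′ x | join-cases M M′ y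
    ... | inj₁ (_ , Jx≡M′x) | inj₁ (_ , Jy≡M′y) = M′-inj (trans (sym Jx≡M′x) (trans Jx≡Jy Jy≡M′y))
    ... | inj₂ (_ , Jx≡Mx)  | inj₂ (_ , Jy≡My)  = M-inj (trans (sym Jx≡Mx) (trans Jx≡Jy Jy≡My))
    ... | inj₁ (better-x , Jx≡M′x) | inj₂ (¬better-y , Jy≡My) =
      contradiction (better-reflected M-stab M′-stab (trans (sym Jy≡My) (trans (sym Jx≡Jy) Jx≡M′x)) better-x)
                    ¬better-y
    ... | inj₂ (¬better-x , Jx≡Mx) | inj₁ (better-y , Jy≡M′y) =
      contradiction (better-reflected M-stab M′-stab (trans (sym Jx≡Mx) (trans Jx≡Jy Jy≡M′y)) better-y)
                    ¬better-x

    meet-injective : Injective _≡_ _≡_ (meet I M M′)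
    meet-injective {x} {y} Kx≡Ky with meet-cases M M′ x | meet-cases M M′ y
    ... | inj₁ (_ , Kx≡Mx)  | inj₁ (_ , Ky≡My)  = M-inj (trans (sym Kx≡Mx) (trans Kx≡Ky Ky≡My))
    ... | inj₂ (_ , Kx≡M′x) | inj₂ (_ , Ky≡M′y) = M′-inj (trans (sym Kx≡M′x) (trans Kx≡Ky Ky≡M′y))
    ... | inj₁ (better-x , Kx≡Mx) | inj₂ (¬better-y , Ky≡M′y) =
      contradiction (better-closed M-stab M′-stab better-x (trans (sym Ky≡M′y) (trans (sym Kx≡Ky) Kx≡Mx)))
                    ¬better-y
    ... | inj₂ (¬better-x , Kx≡M′x) | inj₁ (better-y , Ky≡My) =
      contradiction (better-closed M-stab M′-stab better-y (trans (sym Kx≡M′x) (trans Kx≡Ky Ky≡My)))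
                    ¬better-x

    meet-stable : IsStable I (meet I M M′)
    meet-stable = meet-injective , unblocked
      where
      K = meet I M M′

      prefers-both : ∀ {w f} → Prefers (wpref I w) f (K w) →
        Prefers (wpref I w) f (M w) × Prefers (wpref I w) f (M′ w)
      prefers-both {w} {f} f≺Kw with meet-cases M M′ w
      ... | inj₁ (better , Kw≡Mw) = let f≺Mw = subst (Prefers (wpref I w) f) Kw≡Mw f≺Kw in
                                     f≺Mw , <-trans f≺Mw better
      ... | inj₂ (¬better , Kw≡M′w) = let f≺M′w = subst (Prefers (wpref I w) f) Kw≡M′w f≺Kw in
                                       ℕ.<-≤-trans f≺M′w (ℕ.≮⇒≥ ¬better) , f≺M′w

      unblocked : ∀ w f → ¬ Blocking I K w f
      unblocked w f (_ , f≺Kw , w≺partners) with injective⇒surjective K meet-injective f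
      ... | w′ , Kw′≡f with meet-cases M M′ w′
      ...   | inj₁ (_ , Kw′≡Mw′) = proj₂ M-stab w f
              (blocking M-inj (trans (sym Kw′≡Mw′) Kw′≡f) (proj₁ (prefers-both f≺Kw)) (w≺partners w′ Kw′≡f))
      ...   | inj₂ (_ , Kw′≡M′w′) = proj₂ M′-stab w f
              (blocking M′-inj (trans (sym Kw′≡M′w′) Kw′≡f) (proj₂ (prefers-both f≺Kw)) (w≺partners w′ Kw′≡f))

    join-partner-preferred : ∀ {w′ u f} → join I M M′ w′ ≡ f → M u ≡ f →
      u ≡ w′ ⊎ Prefers (fpref I f) w′ u
    join-partner-preferred {w′} Jw′≡f Mu≡f with join-cases M M′ w′
    ... | inj₁ (better , Jw′≡M′w′) =
      worse-partner-preferred M-stab M′-stab (trans (sym Jw′≡M′w′) Jw′≡f) Mu≡f (<-asym better)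
    ... | inj₂ (_ , Jw′≡Mw′) = inj₁ (M-inj (trans Mu≡f (trans (sym Jw′≡f) Jw′≡Mw′)))

  join-stable : ∀ {M M′} → IsStable I M → IsStable I M′ → IsStable I (join I M M′)
  join-stable {M} {M′} M-stab M′-stab = join-injective M-stab M′-stab , unblocked
    where
    J = join I M M′

    unblocked : ∀ w f → ¬ Blocking I J w f
    unblocked w f (_ , f≺Jw , w≺partners)
      with injective⇒surjective J (join-injective M-stab M′-stab) f
    ... | w′ , Jw′≡f = blocks-either (join-cases M M′ w)
      where
      w≺w′ : Prefers (fpref I f) w w′
      w≺w′ = w≺partners w′ Jw′≡f

      blocks : ∀ {Z} → IsStable I Z → (∀ {u} → Z u ≡ f → u ≡ w′ ⊎ Prefers (fpref I f) w′ u) →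
        J w ≡ Z w → ⊥
      blocks {Z} (Z-inj , Z-stable) partner-preferred Jw≡Zw with injective⇒surjective Z Z-inj f
      ... | u , Zu≡f =
        Z-stable w f (blocking Z-inj Zu≡f (subst (Prefers (wpref I w) f) Jw≡Zw f≺Jw) w≺u)
        where
        w≺u : Prefers (fpref I f) w u
        w≺u with partner-preferred Zu≡f
        ... | inj₁ refl = w≺w′
        ... | inj₂ w′≺u = <-trans w≺w′ w′≺u

      blocks-either : (Better M M′ w × J w ≡ M′ w) ⊎ (¬ Better M M′ w × J w ≡ M w) → ⊥
      blocks-either (inj₁ (_ , Jw≡M′w)) = blocks M′-stab
        (join-partner-preferred M′-stab M-stab (trans (sym (join-comm M M′ w′)) Jw′≡f)) Jw≡M′w
      blocks-either (inj₂ (_ , Jw≡Mw)) = blocks M-stab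
        (join-partner-preferred M-stab M′-stab Jw′≡f) Jw≡Mw

module _ {N} {A B : Instance N} {w} (same-ranks : ∀ f → rank (wpref A w) f ≡ rank (wpref B w) f) where

  private
    Better-A⇒B : ∀ {M M′} → Better A M M′ w → Better B M M′ w
    Better-A⇒B = subst₂ _<_ (same-ranks _) (same-ranks _)

    Better-B⇒A : ∀ {M M′} → Better B M M′ w → Better A M M′ w
    Better-B⇒A = subst₂ _<_ (sym (same-ranks _)) (sym (same-ranks _))

  join-cong : ∀ M M′ → join A M M′ w ≡ join B M M′ w
  join-cong M M′ with join-cases A M M′ w | join-cases B M M′ w
  ... | inj₁ (_ , JA≡M′) | inj₁ (_ , JB≡M′) = trans JA≡M′ (sym JB≡M′)
  ... | inj₂ (_ , JA≡M)  | inj₂ (_ , JB≡M)  = trans JA≡M (sym JB≡M)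
  ... | inj₁ (better , _) | inj₂ (¬better , _) = contradiction (Better-A⇒B {M} {M′} better) ¬better
  ... | inj₂ (¬better , _) | inj₁ (better , _) = contradiction (Better-B⇒A {M} {M′} better) ¬better

  meet-cong : ∀ M M′ → meet A M M′ w ≡ meet B M M′ w
  meet-cong M M′ with meet-cases A M M′ w | meet-cases B M M′ w
  ... | inj₁ (_ , KA≡M)  | inj₁ (_ , KB≡M)  = trans KA≡M (sym KB≡M)
  ... | inj₂ (_ , KA≡M′) | inj₂ (_ , KB≡M′) = trans KA≡M′ (sym KB≡M′)
  ... | inj₁ (better , _) | inj₂ (¬better , _) = contradiction (Better-A⇒B {M} {M′} better) ¬better
  ... | inj₂ (¬better , _) | inj₁ (better , _) = contradiction (Better-B⇒A {M} {M′} better) ¬better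

Is1n-sym : ∀ {n} (A B : Instance (suc n)) → Is1n A B → Is1n B A
Is1n-sym A B A≈B w w≢0 f = sym (A≈B w w≢0 f)

InBoth-closed : ∀ {n} (A B : Instance (suc n)) → Is1n A B → ∀ M M′ →
  InBoth A B M → InBoth A B M′ → InBoth A B (join A M M′) × InBoth A B (meet A M M′)
InBoth-closed A B A≈B M M′ (MA , MB) (M′A , M′B) =
  (join-stable A MA M′A , IsStable-resp-≗ B joinB≗joinA (join-stable B MB M′B)) ,
  (meet-stable A MA M′A , IsStable-resp-≗ B meetB≗meetA (meet-stable B MB M′B))
  where
  joinB≗joinA : join B M M′ ≗ join A M M′
  joinB≗joinA = injective-agree-off-point (join-injective B MB M′B) (join-injective A MA M′A) zero
                  (λ w w≢0 → sym (join-cong {A = A} {B} (A≈B w w≢0) M M′))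

  meetB≗meetA : meet B M M′ ≗ meet A M M′
  meetB≗meetA = injective-agree-off-point (meet-injective B MB M′B) (meet-injective A MA M′A) zero
                  (λ w w≢0 → sym (meet-cong {A = A} {B} (A≈B w w≢0) M M′))

theorem11 : ∀ (n : ℕ) (A B : Instance (suc n)) → Is1n A B →
    IsSublattice A (InBoth A B) × IsSublattice B (InBoth A B)
theorem11 n A B A≈B =
  ((λ _ → proj₁) , InBoth-closed A B A≈B) ,
  ((λ _ → proj₂) , λ M M′ M∈ M′∈ →
    map swap swap (InBoth-closed B A (Is1n-sym A B A≈B) M M′ (swap M∈) (swap M′∈)))
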